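{- Let $n\geq 16$ be an integer with $n\equiv 4 \pmod{12}$. Then there exists a $3$-star system of order $n$ which is $n$-block-colourable.
   Context: A $3$-star is a copy of the complete bipartite graph $K_{1,3}$. A $3$-star system of order $n$ is a pair $(V,\mathcal{B})$ where $|V|=n$ and $\mathcal{B}$ is a set of $3$-stars (subgraphs of the complete graph $K_n$ on $V$) whose edge sets partition the edge set of $K_n$; the elements of $\mathcal B$ are called blocks. A block-colouring is a partition of $\mathcal{B}$ into colour classes such that the blocks in each colour class are pairwise vertex-disjoint. The system is $k$-block-colourable if it admits a block-colouring with $k$ colour classes. -}

module Defs where

open import Data.Nat using (ℕ)
open import Data.Fin using (Fin)
open import Data.List using (List; length; lookup)
open import Data.Product using (Σ; _×_; ∃)
open import Data.Sum using (_⊎_)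
open import Data.Empty using (⊥)
open import Relation.Nullary using (¬_)
open import Relation.Binary.PropositionalEquality using (_≡_; _≢_)
open import Function.Definitions using (Surjective)

record Star (V : Set) : Set where
  field
    centre : V
    leaf₁ leaf₂ leaf₃ : V
    c≢1 : centre ≢ leaf₁
    c≢2 : centre ≢ leaf₂
    c≢3 : centre ≢ leaf₃
    1≢2 : leaf₁ ≢ leaf₂
    1≢3 : leaf₁ ≢ leaf₃
    2≢3 : leaf₂ ≢ leaf₃

open Star public

IsLeaf : {V : Set} → Star V → V → Set
IsLeaf s v = (v ≡ leaf₁ s ⊎ v ≡ leaf₂ s) ⊎ v ≡ leaf₃ s

InStar : {V : Set} → V → Star V → Set
InStar v s = v ≡ centre s ⊎ IsLeaf s v

HasEdge : {V : Set} → Star V → V → V → Set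
HasEdge s x y = (x ≡ centre s × IsLeaf s y) ⊎ (y ≡ centre s × IsLeaf s x)

IsStarSystem : (n : ℕ) → List (Star (Fin n)) → Set
IsStarSystem n B =
  (x y : Fin n) → x ≢ y →
  Σ (Fin (length B)) λ i →
    HasEdge (lookup B i) x y ×
    ((j : Fin (length B)) → HasEdge (lookup B j) x y → j ≡ i)

VertexDisjoint : {V : Set} → Star V → Star V → Set
VertexDisjoint s t = ∀ v → ¬ (InStar v s × InStar v t)

-- A block-colouring with k colour classes: a map from blocks onto k
-- colours (surjective, so that there are exactly k nonempty colour
-- classes) such that distinct blocks of the same colour are
-- vertex-disjoint.
IsBlockColouring : {V : Set} (B : List (Star V)) (k : ℕ) →
                   (Fin (length B) → Fin k) → Set
IsBlockColouring B k col =
  Surjective _≡_ _≡_ col ×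
  ((i j : Fin (length B)) → i ≢ j → col i ≡ col j →
     VertexDisjoint (lookup B i) (lookup B j))

BlockColourable : {V : Set} (B : List (Star V)) (k : ℕ) → Set
BlockColourable B k = ∃ λ col → IsBlockColouring B k col

-- Write n = 1 + 3s with s = 2D + 1 and D ≥ 2, and take as vertices ∞ and (i, a) with i ∈ ℤ₃,
-- a ∈ ℤₛ. Writing {centre; leaves}, the blocks are the hubs {∞; (0,a), (1,a), (2,a)}, the bases
-- {(0,a); (1,a), (1,a−1), (2,a)} and, for each level i and 1 ≤ d ≤ D, the arms
-- {(i,a); (i,a+d), (i+1,a+d), (i+2,a+d)}; only the arm at (1,a) with d = 1 takes (2,a) in place of
-- (0,a+1), that edge being covered by the base at a+1. Each edge lies in exactly one block, which
-- is read off from the levels of its ends and their difference 0 or ±d in ℤₛ.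
-- As s is odd, 2 is invertible modulo s. Colour the arm at (i,a) of length d by (i, a + d/2), the
-- hub at a by (0,a) if a ≠ 0 and by ∞ if a = 0, and the base at a by (2,a): these are n colours.
-- The arms coloured (i,c) occupy the positions c ± d/2, which are distinct for distinct d and
-- differ from c, and from c − 1 since d ≠ −2 when D ≥ 2; so each colour class is vertex-disjoint.

{-# OPTIONS --safe #-}
module Submission where

open import Defs
open import Data.Empty using (⊥; ⊥-elim)
open import Data.Fin as Fin using (Fin; suc; toℕ; fromℕ<; cast)
open import Data.Fin.Patterns using (0F; 1F; 2F)
import Data.Fin.Properties as Fin
open import Data.Integer using (ℤ; +_; +[1+_]; -[1+_]; _+_; _*_; -_; 0ℤ)
import Data.Integer.Properties as ℤ
open import Data.Integer.Tactic.RingSolver using (solve-∀)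
open import Data.List using (List; length; lookup; tabulate)
open import Data.List.Properties using (length-tabulate; lookup-tabulate)
open import Data.Nat as ℕ using (ℕ; zero; suc; NonZero; _<_; _≤_; _≥_)
import Data.Nat.Properties as ℕ
open import Data.Nat.DivMod using (_%_; _/_; m%n<n; m≡m%n+[m/n]*n; m∣n⇒o%n%m≡o%m)
open import Data.Nat.Divisibility using (divides)
import Data.Nat.Tactic.RingSolver as ℕSolver
open import Data.Product using (Σ; _×_; _,_; proj₁; proj₂; uncurry)
open import Data.Product.Function.NonDependent.Propositional using (_×-↔_)
open import Data.Sum using (_⊎_; inj₁; inj₂; swap) renaming (map to ⊎-map)
open import Function using (_∘_; _↔_; Inverse; Injection; mk↔ₛ′)
open import Function.Consequences.Propositional using (strictlySurjective⇒surjective)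
open import Function.Definitions using (StrictlySurjective)
open import Function.Properties.Inverse using (↔⇒↣; ↔-refl; ↔-sym; ↔-trans)
open import Relation.Binary.Bundles using (Setoid)
import Relation.Binary.Reasoning.Setoid
open import Relation.Binary.Structures using (IsEquivalence)
open import Relation.Binary.PropositionalEquality
open import Relation.Nullary using (¬_; yes; no)

IsDecomposition : {V I : Set} → (I → Star V) → Set
IsDecomposition {V} {I} f = (x y : V) → x ≢ y →
  Σ I λ i → HasEdge (f i) x y × ((j : I) → HasEdge (f j) x y → j ≡ i)

IsColouring : {V I C : Set} → (I → Star V) → (I → C) → Set
IsColouring {I = I} f col = StrictlySurjective _≡_ col ×
  ((i j : I) → i ≢ j → col i ≡ col j → VertexDisjoint (f i) (f j))

VertexDisjoint-sym : {V : Set} {s t : Star V} → VertexDisjoint s t → VertexDisjoint t s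
VertexDisjoint-sym s#t v (v∈t , v∈s) = s#t v (v∈s , v∈t)

module _ {A B : Set} (e : A ↔ B) where
  open Inverse e

  to-injective : ∀ {x y} → to x ≡ to y → x ≡ y
  to-injective = Injection.injective (↔⇒↣ e)

  from-injective : ∀ {x y} → from x ≡ from y → x ≡ y
  from-injective = Injection.injective (↔⇒↣ (↔-sym e))

module _ {I J : Set} (e : J ↔ I) where
  open Inverse e

  decomposition-reindex : {V : Set} {f : I → Star V} {g : J → Star V} →
    g ≗ f ∘ to → IsDecomposition f → IsDecomposition g
  decomposition-reindex {f = f} {g} g≗f∘to dec x y x≢y =
    let i , i∋xy , unique = dec x y x≢y
    in from i
     , subst (λ b → HasEdge b x y) (sym (trans (g≗f∘to (from i)) (cong f (strictlyInverseˡ i)))) i∋xy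
     , λ j j∋xy → trans (sym (strictlyInverseʳ j))
                        (cong from (unique (to j) (subst (λ b → HasEdge b x y) (g≗f∘to j) j∋xy)))

  colouring-reindex : {V C : Set} {f : I → Star V} {g : J → Star V} {col : I → C} →
    g ≗ f ∘ to → IsColouring f col → IsColouring g (col ∘ to)
  colouring-reindex {col = col} g≗f∘to (onto , disjoint) =
      (λ c → let i , coli≡c = onto c in from i , trans (cong col (strictlyInverseˡ i)) coli≡c)
    , λ i j i≢j same-colour → subst₂ VertexDisjoint (sym (g≗f∘to i)) (sym (g≗f∘to j))
                                (disjoint (to i) (to j) (i≢j ∘ to-injective e) same-colour)

module _ {V W : Set} (e : V ↔ W) where
  open Inverse e

  mapStar : Star V → Star W
  mapStar s = record
    { centre = to (centre s) ; leaf₁ = to (leaf₁ s) ; leaf₂ = to (leaf₂ s) ; leaf₃ = to (leaf₃ s)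
    ; c≢1 = c≢1 s ∘ to-injective e ; c≢2 = c≢2 s ∘ to-injective e ; c≢3 = c≢3 s ∘ to-injective e
    ; 1≢2 = 1≢2 s ∘ to-injective e ; 1≢3 = 1≢3 s ∘ to-injective e ; 2≢3 = 2≢3 s ∘ to-injective e }

  private
    from-≡ : ∀ {w v} → w ≡ to v → from w ≡ v
    from-≡ {v = v} refl = strictlyInverseʳ v

    to-≡ : ∀ {w v} → from w ≡ v → w ≡ to v
    to-≡ {w} refl = sym (strictlyInverseˡ w)

    isLeaf-mapStar⁻ : ∀ s w → IsLeaf (mapStar s) w → IsLeaf s (from w)
    isLeaf-mapStar⁻ s w = ⊎-map (⊎-map from-≡ from-≡) from-≡

    isLeaf-mapStar⁺ : ∀ s w → IsLeaf s (from w) → IsLeaf (mapStar s) w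
    isLeaf-mapStar⁺ s w = ⊎-map (⊎-map to-≡ to-≡) to-≡

  hasEdge-mapStar⁻ : ∀ s x y → HasEdge (mapStar s) x y → HasEdge s (from x) (from y)
  hasEdge-mapStar⁻ s x y =
    ⊎-map (λ (c , l) → from-≡ c , isLeaf-mapStar⁻ s y l) (λ (c , l) → from-≡ c , isLeaf-mapStar⁻ s x l)

  hasEdge-mapStar⁺ : ∀ s x y → HasEdge s (from x) (from y) → HasEdge (mapStar s) x y
  hasEdge-mapStar⁺ s x y =
    ⊎-map (λ (c , l) → to-≡ c , isLeaf-mapStar⁺ s y l) (λ (c , l) → to-≡ c , isLeaf-mapStar⁺ s x l)

  inStar-mapStar⁻ : ∀ s w → InStar w (mapStar s) → InStar (from w) s
  inStar-mapStar⁻ s w = ⊎-map from-≡ (isLeaf-mapStar⁻ s w)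

  decomposition-map : {I : Set} {f : I → Star V} → IsDecomposition f → IsDecomposition (mapStar ∘ f)
  decomposition-map {f = f} dec x y x≢y =
    let i , i∋xy , unique = dec (from x) (from y) (x≢y ∘ from-injective e)
    in i , hasEdge-mapStar⁺ (f i) x y i∋xy , λ j j∋xy → unique j (hasEdge-mapStar⁻ (f j) x y j∋xy)

  colouring-map : {I : Set} {f : I → Star V} {col : I → V} →
    IsColouring f col → IsColouring (mapStar ∘ f) (to ∘ col)
  colouring-map {f = f} (onto , disjoint) =
      (λ w → let i , coli≡ = onto (from w) in i , trans (cong to coli≡) (strictlyInverseˡ w))
    , λ i j i≢j same-colour w (w∈i , w∈j) →
        disjoint i j i≢j (to-injective e same-colour) (from w)
                 (inStar-mapStar⁻ (f i) w w∈i , inStar-mapStar⁻ (f j) w w∈j)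

module _ {A : Set} {m : ℕ} (f : Fin m → A) where

  tabulate-index : Fin (length (tabulate f)) ↔ Fin m
  tabulate-index = mk↔ₛ′ (cast eq) (cast (sym eq)) (Fin.cast-involutive eq (sym eq)) (Fin.cast-involutive (sym eq) eq)
    where
    eq : length (tabulate f) ≡ m
    eq = length-tabulate f

  lookup-tabulate′ : lookup (tabulate f) ≗ f ∘ Inverse.to tabulate-index
  lookup-tabulate′ i =
    subst (λ j → lookup (tabulate f) j ≡ f (Inverse.to tabulate-index i))
          (Fin.cast-involutive (sym (length-tabulate f)) (length-tabulate f) i)
          (lookup-tabulate f (Inverse.to tabulate-index i))

toStarSystem : {V I : Set} {n m : ℕ} → V ↔ Fin n → I ↔ Fin m →
  {f : I → Star V} {col : I → V} → IsDecomposition f → IsColouring f col →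
  Σ (List (Star (Fin n))) λ B → IsStarSystem n B × BlockColourable B n
toStarSystem {I = I} {n} {m} vertices blocks {f} {col} dec colouring =
  tabulate g , decomposition-reindex index {f = mapStar vertices ∘ f} lookup≗ (decomposition-map vertices {f = f} dec)
             , _ , strictlySurjective⇒surjective (proj₁ colouring′) , proj₂ colouring′
  where
  g : Fin m → Star (Fin n)
  g = mapStar vertices ∘ f ∘ Inverse.from blocks

  index : Fin (length (tabulate g)) ↔ I
  index = ↔-trans (tabulate-index g) (↔-sym blocks)

  lookup≗ : lookup (tabulate g) ≗ mapStar vertices ∘ f ∘ Inverse.to index
  lookup≗ = lookup-tabulate′ g

  colouring′ : IsColouring (lookup (tabulate g)) (Inverse.to vertices ∘ col ∘ Inverse.to index)
  colouring′ = colouring-reindex index {f = mapStar vertices ∘ f} lookup≗ (colouring-map vertices {f = f} colouring)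

module Modulo (m : ℤ) where

  infix 4 _≈_
  infix 1 _by_
  record _≈_ (x y : ℤ) : Set where
    constructor _by_
    field
      quotient : ℤ
      equation : x ≡ y + quotient * m

  ≈-reflexive : ∀ {x y} → x ≡ y → x ≈ y
  ≈-reflexive {x} refl = 0ℤ by lemma x m
    where lemma : ∀ x m → x ≡ x + 0ℤ * m
          lemma = solve-∀

  ≈-refl : ∀ {x} → x ≈ x
  ≈-refl = ≈-reflexive refl

  ≈-sym : ∀ {x y} → x ≈ y → y ≈ x
  ≈-sym {y = y} (q by refl) = (- q) by lemma y q m
    where lemma : ∀ y q m → y ≡ (y + q * m) + (- q) * m
          lemma = solve-∀

  ≈-trans : ∀ {x y z} → x ≈ y → y ≈ z → x ≈ z
  ≈-trans {z = z} (q by refl) (r by refl) = (q + r) by lemma z q r m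
    where lemma : ∀ z q r m → (z + r * m) + q * m ≡ z + (q + r) * m
          lemma = solve-∀

  ≈-isEquivalence : IsEquivalence _≈_
  ≈-isEquivalence = record { refl = ≈-refl ; sym = ≈-sym ; trans = ≈-trans }

  ≈-setoid : Setoid _ _
  ≈-setoid = record { isEquivalence = ≈-isEquivalence }

  +-cong : ∀ {x y u v} → x ≈ y → u ≈ v → x + u ≈ y + v
  +-cong {y = y} {v = v} (q by refl) (r by refl) = (q + r) by lemma y v q r m
    where lemma : ∀ y v q r m → (y + q * m) + (v + r * m) ≡ (y + v) + (q + r) * m
          lemma = solve-∀

  *-congˡ : ∀ c {x y} → x ≈ y → c * x ≈ c * y
  *-congˡ c {y = y} (q by refl) = (c * q) by lemma c y q m
    where lemma : ∀ c y q m → c * (y + q * m) ≡ c * y + (c * q) * m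
          lemma = solve-∀

  +-cancelˡ : ∀ c {x y} → c + x ≈ c + y → x ≈ y
  +-cancelˡ c {x} {y} (q by eq) = q by (begin
      x                   ≡⟨ add-sub c x ⟩
      (c + x) + - c       ≡⟨ cong (_+ - c) eq ⟩
      (c + y + q * m) + - c ≡⟨ sub-add c y q m ⟩
      y + q * m           ∎)
    where
    open ≡-Reasoning
    add-sub : ∀ c x → x ≡ (c + x) + - c
    add-sub = solve-∀
    sub-add : ∀ c y q m → (c + y + q * m) + - c ≡ y + q * m
    sub-add = solve-∀

  +-modulus : ∀ x → x + m ≈ x
  +-modulus x = + 1 by lemma x m
    where lemma : ∀ x m → x + m ≡ x + + 1 * m
          lemma = solve-∀


module CyclicShift (s : ℕ) .{{_ : NonZero s}} where
  open Modulo (+ s) public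

  ⟦_⟧ : Fin s → ℤ
  ⟦ a ⟧ = + toℕ a

  infixl 6 _⊕_
  _⊕_ : Fin s → ℕ → Fin s
  a ⊕ k = fromℕ< (m%n<n (toℕ a ℕ.+ k) s)

  ⟦⊕⟧ : ∀ a k → ⟦ a ⊕ k ⟧ ≈ ⟦ a ⟧ + + k
  ⟦⊕⟧ a k = ≈-sym (+ (n / s) by (begin
      ⟦ a ⟧ + + k                  ≡⟨ ℤ.pos-+ (toℕ a) k ⟨
      + n                          ≡⟨ cong +_ (m≡m%n+[m/n]*n n s) ⟩
      + (n % s ℕ.+ n / s ℕ.* s)    ≡⟨ ℤ.pos-+ (n % s) _ ⟩
      + (n % s) + + (n / s ℕ.* s)  ≡⟨ cong₂ _+_ (cong +_ (Fin.toℕ-fromℕ< _)) (sym (ℤ.pos-* (n / s) s)) ⟨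
      ⟦ a ⊕ k ⟧ + + (n / s) * + s  ∎))
    where
    open ≡-Reasoning
    n : ℕ
    n = toℕ a ℕ.+ k

  private
    multiple-≥ : ∀ x y q → + x ≡ + y + +[1+ q ] * + s → s ≤ x
    multiple-≥ x y q eq = subst (s ≤_) (sym (ℤ.+-injective x≡)) (ℕ.≤-trans (ℕ.m≤m+n s (q ℕ.* s)) (ℕ.m≤n+m _ y))
      where x≡ : + x ≡ + (y ℕ.+ suc q ℕ.* s)
            x≡ = trans eq (sym (trans (ℤ.pos-+ y _) (cong (_+_ (+ y)) (ℤ.pos-* (suc q) s))))

  ≈-canonical : ∀ {x y} → x < s → y < s → + x ≈ + y → x ≡ y
  ≈-canonical {x} {y} _ _ (+ zero by eq) = ℤ.+-injective (trans eq (ℤ.+-identityʳ (+ y)))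
  ≈-canonical {x} {y} x<s _ (+[1+ q ] by eq) = ⊥-elim (ℕ.<⇒≱ x<s (multiple-≥ x y q eq))
  ≈-canonical {x} {y} _ y<s (-[1+ q ] by eq) =
    ⊥-elim (ℕ.<⇒≱ y<s (multiple-≥ y x q (move (+ x) (+ y) +[1+ q ] (+ s) eq)))
    where
    move : ∀ x y q m → x ≡ y + (- q) * m → y ≡ x + q * m
    move x y q m refl = lemma y q m
      where lemma : ∀ y q m → y ≡ (y + (- q) * m) + q * m
            lemma = solve-∀

  ⟦⟧-injective : ∀ {a b} → ⟦ a ⟧ ≈ ⟦ b ⟧ → a ≡ b
  ⟦⟧-injective {a} {b} = Fin.toℕ-injective ∘ ≈-canonical (Fin.toℕ<n a) (Fin.toℕ<n b)

  module ≈-Reasoning = Relation.Binary.Reasoning.Setoid ≈-setoid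

  ⊕-identityʳ : ∀ a → a ⊕ 0 ≡ a
  ⊕-identityʳ a = ⟦⟧-injective (≈-trans (⟦⊕⟧ a 0) (≈-reflexive (ℤ.+-identityʳ ⟦ a ⟧)))

  ⊕-assoc : ∀ a k l → a ⊕ k ⊕ l ≡ a ⊕ (k ℕ.+ l)
  ⊕-assoc a k l = ⟦⟧-injective (begin
      ⟦ a ⊕ k ⊕ l ⟧        ≈⟨ ⟦⊕⟧ (a ⊕ k) l ⟩
      ⟦ a ⊕ k ⟧ + + l      ≈⟨ +-cong (⟦⊕⟧ a k) (≈-refl {+ l}) ⟩
      ⟦ a ⟧ + + k + + l    ≡⟨ ℤ.+-assoc ⟦ a ⟧ (+ k) (+ l) ⟩
      ⟦ a ⟧ + (+ k + + l)  ≡⟨ cong (_+_ ⟦ a ⟧) (ℤ.pos-+ k l) ⟨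
      ⟦ a ⟧ + + (k ℕ.+ l)  ≈⟨ ⟦⊕⟧ a (k ℕ.+ l) ⟨
      ⟦ a ⊕ (k ℕ.+ l) ⟧    ∎)
    where open ≈-Reasoning

  ⊕-modulus : ∀ a → a ⊕ s ≡ a
  ⊕-modulus a = ⟦⟧-injective (≈-trans (⟦⊕⟧ a s) (+-modulus ⟦ a ⟧))

  ⊕-cancelˡ : ∀ a {k l} → k < s → l < s → a ⊕ k ≡ a ⊕ l → k ≡ l
  ⊕-cancelˡ a {k} {l} k<s l<s eq = ≈-canonical k<s l<s (+-cancelˡ ⟦ a ⟧ (begin
      ⟦ a ⟧ + + k  ≈⟨ ⟦⊕⟧ a k ⟨
      ⟦ a ⊕ k ⟧    ≡⟨ cong ⟦_⟧ eq ⟩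
      ⟦ a ⊕ l ⟧    ≈⟨ ⟦⊕⟧ a l ⟩
      ⟦ a ⟧ + + l  ∎))
    where open ≈-Reasoning

  ⊕-cancelʳ : ∀ {a b} k → a ⊕ k ≡ b ⊕ k → a ≡ b
  ⊕-cancelʳ {a} {b} k eq = ⟦⟧-injective (+-cancelˡ (+ k) (begin
      + k + ⟦ a ⟧  ≡⟨ ℤ.+-comm (+ k) ⟦ a ⟧ ⟩
      ⟦ a ⟧ + + k  ≈⟨ ⟦⊕⟧ a k ⟨
      ⟦ a ⊕ k ⟧    ≡⟨ cong ⟦_⟧ eq ⟩
      ⟦ b ⊕ k ⟧    ≈⟨ ⟦⊕⟧ b k ⟩
      ⟦ b ⟧ + + k  ≡⟨ ℤ.+-comm ⟦ b ⟧ (+ k) ⟩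
      + k + ⟦ b ⟧  ∎))
    where open ≈-Reasoning

  ⊕-difference : ∀ a b → Σ ℕ λ k → k < s × b ≡ a ⊕ k
  ⊕-difference a b = toℕ c , Fin.toℕ<n c , ⟦⟧-injective (begin
      ⟦ b ⟧                               ≈⟨ +-modulus ⟦ b ⟧ ⟨
      ⟦ b ⟧ + + s                         ≡⟨ cong (_+_ ⟦ b ⟧) (cong +_ (ℕ.m∸n+n≡m (ℕ.<⇒≤ (Fin.toℕ<n a)))) ⟨
      ⟦ b ⟧ + + (s ℕ.∸ toℕ a ℕ.+ toℕ a)   ≡⟨ cong (_+_ ⟦ b ⟧) (ℤ.pos-+ (s ℕ.∸ toℕ a) (toℕ a)) ⟩
      ⟦ b ⟧ + (+ (s ℕ.∸ toℕ a) + ⟦ a ⟧)   ≡⟨ rearrange ⟦ b ⟧ (+ (s ℕ.∸ toℕ a)) ⟦ a ⟧ ⟩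
      ⟦ a ⟧ + (⟦ b ⟧ + + (s ℕ.∸ toℕ a))   ≈⟨ +-cong (≈-refl {⟦ a ⟧}) (⟦⊕⟧ b (s ℕ.∸ toℕ a)) ⟨
      ⟦ a ⟧ + ⟦ c ⟧                       ≈⟨ ⟦⊕⟧ a (toℕ c) ⟨
      ⟦ a ⊕ toℕ c ⟧                       ∎)
    where
    open ≈-Reasoning
    c : Fin s
    c = b ⊕ (s ℕ.∸ toℕ a)
    rearrange : ∀ x y z → x + (y + z) ≡ z + (x + y)
    rearrange = solve-∀

  ⊕-fixpoint-free : ∀ a {k} → 0 < k → k < s → a ≢ a ⊕ k
  ⊕-fixpoint-free a 0<k k<s eq =
    ℕ.<⇒≢ 0<k (⊕-cancelˡ a (ℕ.≤-<-trans ℕ.z≤n k<s) k<s (trans (⊕-identityʳ a) eq))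

  ≉-shift : ∀ x {k} → 0 < k → k < s → ¬ (x + + k ≈ x)
  ≉-shift x {k} 0<k k<s x+k≈x = ℕ.<⇒≢ 0<k (sym (≈-canonical k<s (ℕ.≤-<-trans ℕ.z≤n k<s)
    (+-cancelˡ x (≈-trans x+k≈x (≈-reflexive (sym (ℤ.+-identityʳ x)))))))


module OddCycle (D : ℕ) where

  s : ℕ
  s = suc (D ℕ.+ D)

  open CyclicShift s public

  δ : Fin D → ℕ
  δ e = suc (toℕ e)

  δ≤D : ∀ e → δ e ≤ D
  δ≤D = Fin.toℕ<n

  δ<s : ∀ e → δ e < s
  δ<s e = ℕ.s≤s (ℕ.≤-trans (δ≤D e) (ℕ.m≤m+n D D))

  δ+δ<s : ∀ e e' → δ e ℕ.+ δ e' < s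
  δ+δ<s e e' = ℕ.s≤s (ℕ.+-mono-≤ (δ≤D e) (δ≤D e'))

  δ-injective : ∀ {e e'} → δ e ≡ δ e' → e ≡ e'
  δ-injective = Fin.toℕ-injective ∘ ℕ.suc-injective

  residue-trichotomy : ∀ k → k < s →
    k ≡ 0 ⊎ (Σ (Fin D) λ e → k ≡ δ e) ⊎ (Σ (Fin D) λ e → k ℕ.+ δ e ≡ s)
  residue-trichotomy zero _ = inj₁ refl
  residue-trichotomy (suc j) j<2D with j ℕ.<? D
  ... | yes j<D = inj₂ (inj₁ (fromℕ< j<D , cong suc (sym (Fin.toℕ-fromℕ< j<D))))
  ... | no j≮D with ℕ.m≤n⇒∃[o]m+o≡n (ℕ.≮⇒≥ j≮D)
  ...   | r , refl with ℕ.m≤n⇒∃[o]m+o≡n (ℕ.+-cancelˡ-< D r D (ℕ.s≤s⁻¹ j<2D))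
  ...     | q , r+q≡D = inj₂ (inj₂ (fromℕ< q<D , (begin
      suc (D ℕ.+ r) ℕ.+ suc (toℕ (fromℕ< q<D))  ≡⟨ cong (λ x → suc (D ℕ.+ r) ℕ.+ suc x) (Fin.toℕ-fromℕ< q<D) ⟩
      suc (D ℕ.+ r) ℕ.+ suc q                  ≡⟨ regroup D r q ⟩
      suc (D ℕ.+ (suc r ℕ.+ q))                ≡⟨ cong (λ x → suc (D ℕ.+ x)) r+q≡D ⟩
      s                                         ∎)))
    where
    open ≡-Reasoning
    q<D : q < D
    q<D = subst (q <_) r+q≡D (ℕ.m<n+m q (ℕ.s≤s ℕ.z≤n))
    regroup : ∀ D r q → suc (D ℕ.+ r) ℕ.+ suc q ≡ suc (D ℕ.+ (suc r ℕ.+ q))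
    regroup = ℕSolver.solve-∀

  Pos : Set
  Pos = Fin s

  data Offset (a b : Pos) : Set where
    same     : b ≡ a → Offset a b
    forward  : (e : Fin D) → b ≡ a ⊕ δ e → Offset a b
    backward : (e : Fin D) → a ≡ b ⊕ δ e → Offset a b

  opaque
    offset : ∀ a b → Offset a b
    offset a b with ⊕-difference a b
    ... | k , k<s , b≡a⊕k with residue-trichotomy k k<s
    ...   | inj₁ refl = same (trans b≡a⊕k (⊕-identityʳ a))
    ...   | inj₂ (inj₁ (e , refl)) = forward e b≡a⊕k
    ...   | inj₂ (inj₂ (e , k+δ≡s)) = backward e (begin
        a                ≡⟨ ⊕-modulus a ⟨
        a ⊕ s            ≡⟨ cong (a ⊕_) k+δ≡s ⟨
        a ⊕ (k ℕ.+ δ e)  ≡⟨ ⊕-assoc a k (δ e) ⟨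
        a ⊕ k ⊕ δ e      ≡⟨ cong (_⊕ δ e) b≡a⊕k ⟨
        b ⊕ δ e          ∎)
      where open ≡-Reasoning

  ⊕δ-injective : ∀ a {e e'} → a ⊕ δ e ≡ a ⊕ δ e' → e ≡ e'
  ⊕δ-injective a {e} {e'} = δ-injective ∘ ⊕-cancelˡ a (δ<s e) (δ<s e')

  ⊕δ-fixpoint-free : ∀ a e → a ≢ a ⊕ δ e
  ⊕δ-fixpoint-free a e = ⊕-fixpoint-free a (ℕ.s≤s ℕ.z≤n) (δ<s e)

  ⊕δ⊕δ-fixpoint-free : ∀ a e e' → a ≢ a ⊕ δ e ⊕ δ e'
  ⊕δ⊕δ-fixpoint-free a e e' eq =
    ⊕-fixpoint-free a (ℕ.s≤s ℕ.z≤n) (δ+δ<s e e') (trans eq (⊕-assoc a (δ e) (δ e')))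

  offset-elim : ∀ {X : Set} {a b} → X → (Fin D → X) → (Fin D → X) → Offset a b → X
  offset-elim x f g (same _)       = x
  offset-elim x f g (forward e _)  = f e
  offset-elim x f g (backward e _) = g e

  module _ {X : Set} {x : X} {f g : Fin D → X} where

    offset-elim-same : ∀ {a} (o : Offset a a) → offset-elim x f g o ≡ x
    offset-elim-same (same _)                 = refl
    offset-elim-same {a} (forward e a≡a⊕δ)   = ⊥-elim (⊕δ-fixpoint-free a e a≡a⊕δ)
    offset-elim-same {a} (backward e a≡a⊕δ)  = ⊥-elim (⊕δ-fixpoint-free a e a≡a⊕δ)

    offset-elim-forward : ∀ {a b e} → b ≡ a ⊕ δ e → (o : Offset a b) → offset-elim x f g o ≡ f e
    offset-elim-forward {a} {e = e} refl (same eq)       = ⊥-elim (⊕δ-fixpoint-free a e (sym eq))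
    offset-elim-forward {a} {e = e} refl (forward e′ eq) = cong f (sym (⊕δ-injective a eq))
    offset-elim-forward {a} {e = e} refl (backward e′ eq) = ⊥-elim (⊕δ⊕δ-fixpoint-free a e e′ eq)

    offset-elim-backward : ∀ {a b e} → a ≡ b ⊕ δ e → (o : Offset a b) → offset-elim x f g o ≡ g e
    offset-elim-backward {b = b} {e} refl (same eq)       = ⊥-elim (⊕δ-fixpoint-free b e eq)
    offset-elim-backward {b = b} {e} refl (forward e′ eq) = ⊥-elim (⊕δ⊕δ-fixpoint-free b e e′ eq)
    offset-elim-backward {b = b} {e} refl (backward e′ eq) = cong g (sym (⊕δ-injective b eq))

  pred : Pos → Pos
  pred a = a ⊕ (D ℕ.+ D)

  suc-pred : ∀ a → pred a ⊕ 1 ≡ a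
  suc-pred a = trans (⊕-assoc a (D ℕ.+ D) 1) (trans (cong (a ⊕_) (ℕ.+-comm (D ℕ.+ D) 1)) (⊕-modulus a))

  pred-suc : ∀ a → pred (a ⊕ 1) ≡ a
  pred-suc a = trans (⊕-assoc a 1 (D ℕ.+ D)) (⊕-modulus a)

  -- mid z k is z + k/2, as 2(D + 1) ≡ 1 modulo s.
  mid : Pos → ℕ → Pos
  mid z k = z ⊕ k ℕ.* suc D

  double-mid : ∀ z k → + 2 * ⟦ mid z k ⟧ ≈ + 2 * ⟦ z ⟧ + + k
  double-mid z k = begin
      + 2 * ⟦ mid z k ⟧                    ≈⟨ *-congˡ (+ 2) (⟦⊕⟧ z (k ℕ.* suc D)) ⟩
      + 2 * (⟦ z ⟧ + + (k ℕ.* suc D))      ≡⟨ cong (λ x → + 2 * (⟦ z ⟧ + x)) (ℤ.pos-* k (suc D)) ⟩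
      + 2 * (⟦ z ⟧ + + k * + suc D)        ≡⟨ expand ⟦ z ⟧ (+ k) (+ D) ⟩
      + 2 * ⟦ z ⟧ + + k + + k * + s        ≈⟨ + k by refl ⟩
      + 2 * ⟦ z ⟧ + + k                    ∎
    where
    open ≈-Reasoning
    expand : ∀ z k d → + 2 * (z + k * (+ 1 + d)) ≡ + 2 * z + k + k * (+ 1 + (d + d))
    expand = solve-∀

  mid-cancelʳ : ∀ {z z'} k → mid z k ≡ mid z' k → z ≡ z'
  mid-cancelʳ k = ⊕-cancelʳ (k ℕ.* suc D)

  mid-onto : ∀ c → mid (c ⊕ D) 1 ≡ c
  mid-onto c = trans (⊕-assoc c D (1 ℕ.* suc D)) (trans (cong (c ⊕_) (sum D)) (⊕-modulus c))
    where sum : ∀ D → D ℕ.+ 1 ℕ.* suc D ≡ suc (D ℕ.+ D)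
          sum = ℕSolver.solve-∀

  Ends : Pos → ℕ → Pos → Set
  Ends z k w = w ≡ z ⊎ w ≡ z ⊕ k

  double-far-end : ∀ z k → + 2 * ⟦ z ⊕ k ⟧ ≈ + 2 * ⟦ mid z k ⟧ + + k
  double-far-end z k = begin
      + 2 * ⟦ z ⊕ k ⟧              ≈⟨ *-congˡ (+ 2) (⟦⊕⟧ z k) ⟩
      + 2 * (⟦ z ⟧ + + k)          ≡⟨ expand ⟦ z ⟧ (+ k) ⟩
      + 2 * ⟦ z ⟧ + + k + + k      ≈⟨ +-cong (double-mid z k) (≈-refl {+ k}) ⟨
      + 2 * ⟦ mid z k ⟧ + + k      ∎
    where
    open ≈-Reasoning
    expand : ∀ z k → + 2 * (z + k) ≡ + 2 * z + k + k
    expand = solve-∀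

  double-end : ∀ {z k w} → Ends z k w →
    + 2 * ⟦ w ⟧ + + k ≈ + 2 * ⟦ mid z k ⟧ ⊎ + 2 * ⟦ w ⟧ ≈ + 2 * ⟦ mid z k ⟧ + + k
  double-end {z} {k} (inj₁ refl) = inj₁ (≈-sym (double-mid z k))
  double-end {z} {k} (inj₂ refl) = inj₂ (double-far-end z k)

  private
    no-antipodal : ∀ {W X a b} → 0 < a → a ℕ.+ b < s → W + + a ≈ X → W ≈ X + + b → ⊥
    no-antipodal {W} {X} {a} {b} 0<a a+b<s p q = ≉-shift W (ℕ.<-≤-trans 0<a (ℕ.m≤m+n a b)) a+b<s (begin
        W + + (a ℕ.+ b)  ≡⟨ ℤ.+-assoc W (+ a) (+ b) ⟨
        W + + a + + b    ≈⟨ +-cong p (≈-refl {+ b}) ⟩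
        X + + b          ≈⟨ q ⟨
        W                ∎)
      where open ≈-Reasoning

  ends-disjoint : ∀ {z z' e e' w} → mid z (δ e) ≡ mid z' (δ e') → e ≢ e' →
    Ends z (δ e) w → Ends z' (δ e') w → ⊥
  ends-disjoint {z} {z'} {e} {e'} {w} c≡c' e≢e' w∈ w∈' = cases (double-end w∈) (double-end w∈')
    where
    W C C' : ℤ
    W = + 2 * ⟦ w ⟧
    C = + 2 * ⟦ mid z (δ e) ⟧
    C' = + 2 * ⟦ mid z' (δ e') ⟧

    C≈C' : C ≈ C'
    C≈C' = ≈-reflexive (cong (λ c → + 2 * ⟦ c ⟧) c≡c')

    cases : W + + δ e ≈ C ⊎ W ≈ C + + δ e → W + + δ e' ≈ C' ⊎ W ≈ C' + + δ e' → ⊥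
    cases (inj₁ p) (inj₁ q) = e≢e' (δ-injective (≈-canonical (δ<s e) (δ<s e')
                                (+-cancelˡ W (≈-trans p (≈-trans C≈C' (≈-sym q))))))
    cases (inj₁ p) (inj₂ q) = no-antipodal (ℕ.s≤s ℕ.z≤n) (δ+δ<s e e') p
                                (≈-trans q (+-cong (≈-sym C≈C') (≈-refl {+ δ e'})))
    cases (inj₂ p) (inj₁ q) = no-antipodal (ℕ.s≤s ℕ.z≤n) (δ+δ<s e' e) q
                                (≈-trans p (+-cong C≈C' (≈-refl {+ δ e})))
    cases (inj₂ p) (inj₂ q) = e≢e' (δ-injective (≈-canonical (δ<s e) (δ<s e')
                                (+-cancelˡ C (≈-trans (≈-sym p) (≈-trans q (+-cong (≈-sym C≈C') (≈-refl {+ δ e'})))))))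

  mid-∉-ends : ∀ z e → ¬ Ends z (δ e) (mid z (δ e))
  mid-∉-ends z e c∈ with double-end c∈
  ... | inj₁ p = ≉-shift _ (ℕ.s≤s ℕ.z≤n) (δ<s e) p
  ... | inj₂ p = ≉-shift _ (ℕ.s≤s ℕ.z≤n) (δ<s e) (≈-sym p)

  double-pred : ∀ c → + 2 * ⟦ pred c ⟧ + + 2 ≈ + 2 * ⟦ c ⟧
  double-pred c = begin
      + 2 * ⟦ pred c ⟧ + + 2       ≡⟨ expand ⟦ pred c ⟧ ⟨
      + 2 * (⟦ pred c ⟧ + + 1)     ≈⟨ *-congˡ (+ 2) (⟦⊕⟧ (pred c) 1) ⟨
      + 2 * ⟦ pred c ⊕ 1 ⟧         ≡⟨ cong (λ x → + 2 * ⟦ x ⟧) (suc-pred c) ⟩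
      + 2 * ⟦ c ⟧                  ∎
    where
    open ≈-Reasoning
    expand : ∀ x → + 2 * (x + + 1) ≡ + 2 * x + + 2
    expand = solve-∀

  pred-mid-≢-far-end : 2 ≤ D → ∀ z e → pred (mid z (δ e)) ≢ z ⊕ δ e
  pred-mid-≢-far-end 2≤D z e eq =
    ≉-shift C (ℕ.s≤s ℕ.z≤n) (ℕ.s≤s (ℕ.+-mono-≤ (δ≤D e) 2≤D)) (begin
      C + + (δ e ℕ.+ 2)                 ≡⟨ ℤ.+-assoc C (+ δ e) (+ 2) ⟨
      C + + δ e + + 2                   ≈⟨ +-cong (double-far-end z (δ e)) (≈-refl {+ 2}) ⟨
      + 2 * ⟦ z ⊕ δ e ⟧ + + 2           ≡⟨ cong (λ x → + 2 * ⟦ x ⟧ + + 2) eq ⟨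
      + 2 * ⟦ pred c ⟧ + + 2            ≈⟨ double-pred c ⟩
      C                                 ∎)
    where
    open ≈-Reasoning
    c : Pos
    c = mid z (δ e)
    C : ℤ
    C = + 2 * ⟦ c ⟧

module Construction (D′ : ℕ) where

  D : ℕ
  D = 2 ℕ.+ D′

  open OddCycle D

  data Vertex : Set where
    ∞  : Vertex
    pt : Fin 3 → Pos → Vertex

  next : Fin 3 → Fin 3
  next 0F = 1F
  next 1F = 2F
  next 2F = 0F

  next-≢ : ∀ i → i ≢ next i
  next-≢ 0F ()
  next-≢ 1F ()
  next-≢ 2F ()

  pt-injectiveˡ : ∀ {i j a b} → pt i a ≡ pt j b → i ≡ j
  pt-injectiveˡ refl = refl

  pt-injectiveʳ : ∀ {i j a b} → pt i a ≡ pt j b → a ≡ b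
  pt-injectiveʳ refl = refl

  data Kind : Set where
    hub  : Kind
    base : Kind
    arm  : Fin 3 → Fin D → Kind

  Block : Set
  Block = Kind × Pos

  armLeaf₃ : Fin 3 → Fin D → Pos → Vertex
  armLeaf₃ 1F 0F z = pt 2F z
  armLeaf₃ i  e  z = pt (next (next i)) (z ⊕ δ e)

  armLeaf₃-≢-level : ∀ i e z w → armLeaf₃ i e z ≢ pt i w
  armLeaf₃-≢-level 0F e z w ()
  armLeaf₃-≢-level 1F 0F z w ()
  armLeaf₃-≢-level 1F (suc e) z w ()
  armLeaf₃-≢-level 2F e z w ()

  armLeaf₃-≢-leaf₂ : ∀ i e z → armLeaf₃ i e z ≢ pt (next i) (z ⊕ δ e)
  armLeaf₃-≢-leaf₂ 0F e z ()
  armLeaf₃-≢-leaf₂ 1F 0F z eq = ⊕δ-fixpoint-free z 0F (pt-injectiveʳ eq)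
  armLeaf₃-≢-leaf₂ 1F (suc e) z ()
  armLeaf₃-≢-leaf₂ 2F e z ()

  star : Block → Star Vertex
  star (hub , z) = record
    { centre = ∞ ; leaf₁ = pt 0F z ; leaf₂ = pt 1F z ; leaf₃ = pt 2F z
    ; c≢1 = λ () ; c≢2 = λ () ; c≢3 = λ () ; 1≢2 = λ () ; 1≢3 = λ () ; 2≢3 = λ () }
  star (base , z) = record
    { centre = pt 0F z ; leaf₁ = pt 1F z ; leaf₂ = pt 1F (pred z) ; leaf₃ = pt 2F z
    ; c≢1 = λ () ; c≢2 = λ () ; c≢3 = λ () ; 1≢3 = λ () ; 2≢3 = λ ()
    ; 1≢2 = λ eq → ⊕-fixpoint-free z (ℕ.s≤s ℕ.z≤n) (ℕ.n<1+n _) (pt-injectiveʳ eq) }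
  star (arm i e , z) = record
    { centre = pt i z ; leaf₁ = pt i (z ⊕ δ e) ; leaf₂ = pt (next i) (z ⊕ δ e) ; leaf₃ = armLeaf₃ i e z
    ; c≢1 = ⊕δ-fixpoint-free z e ∘ pt-injectiveʳ
    ; c≢2 = next-≢ i ∘ pt-injectiveˡ
    ; c≢3 = armLeaf₃-≢-level i e z z ∘ sym
    ; 1≢2 = next-≢ i ∘ pt-injectiveˡ
    ; 1≢3 = armLeaf₃-≢-level i e z (z ⊕ δ e) ∘ sym
    ; 2≢3 = armLeaf₃-≢-leaf₂ i e z ∘ sym }

  data Step : Fin 3 → Fin 3 → Set where
    stay : ∀ {i} → Step i i
    up   : ∀ {i} → Step i (next i)
    down : ∀ {j} → Step (next j) j

  step : ∀ i j → Step i j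
  step 0F 0F = stay
  step 0F 1F = up
  step 0F 2F = down
  step 1F 0F = down
  step 1F 1F = stay
  step 1F 2F = up
  step 2F 0F = up
  step 2F 1F = down
  step 2F 2F = stay

  zeroDiff : Fin 3 → Pos → Block
  zeroDiff 1F a = arm 1F 0F , a
  zeroDiff _  a = base , a

  backDiff : Fin 3 → Fin D → Pos → Pos → Block
  backDiff 0F 0F b a = base , a
  backDiff i  e  b a = arm (next i) e , b

  -- The first argument of offset-elim is junk: for same, a = b and there is no edge.
  sameLevel : Fin 3 → (a b : Pos) → Offset a b → Block
  sameLevel i a b = offset-elim (hub , a) (λ e → arm i e , a) (λ e → arm i e , b)

  upward : Fin 3 → (a b : Pos) → Offset a b → Block
  upward i a b = offset-elim (zeroDiff i a) (λ e → arm i e , a) (λ e → backDiff i e b a)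

  decodeStep : ∀ {i j} → Step i j → Pos → Pos → Block
  decodeStep {i} stay a b = sameLevel i a b (offset a b)
  decodeStep {i} up   a b = upward i a b (offset a b)
  decodeStep {j = j} down a b = upward j b a (offset b a)

  decode : Vertex → Vertex → Block
  decode ∞        ∞        = hub , 0F  -- junk: not an edge
  decode ∞        (pt _ b) = hub , b
  decode (pt _ a) ∞        = hub , a
  decode (pt i a) (pt j b) = decodeStep (step i j) a b

  -- Both orders of an edge between distinct levels decode through the same term.
  both-orders : ∀ {A : Set} {x y : A} → x ≡ y → x ≡ y × x ≡ y
  both-orders p = p , p

  pattern via-leaf₁ p q = inj₁ (p , inj₁ (inj₁ q))
  pattern via-leaf₂ p q = inj₁ (p , inj₁ (inj₂ q))
  pattern via-leaf₃ p q = inj₁ (p , inj₂ q)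

  sameLevel-∋ : ∀ i a b (o : Offset a b) → a ≢ b → HasEdge (star (sameLevel i a b o)) (pt i a) (pt i b)
  sameLevel-∋ i a b (same b≡a)        a≢b = ⊥-elim (a≢b (sym b≡a))
  sameLevel-∋ i a b (forward e refl)  _   = via-leaf₁ refl refl
  sameLevel-∋ i a b (backward e refl) _   = swap (via-leaf₁ refl refl)

  upward-∋ : ∀ i a b (o : Offset a b) → HasEdge (star (upward i a b o)) (pt i a) (pt (next i) b)
  upward-∋ 0F a b (same refl)             = via-leaf₁ refl refl
  upward-∋ 1F a b (same refl)             = via-leaf₃ refl refl
  upward-∋ 2F a b (same refl)             = swap (via-leaf₃ refl refl)
  upward-∋ i  a b (forward e refl)        = via-leaf₂ refl refl
  upward-∋ 0F a b (backward 0F refl)      = via-leaf₂ refl (cong (pt 1F) (sym (pred-suc b)))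
  upward-∋ 0F a b (backward (suc e) refl) = swap (via-leaf₃ refl refl)
  upward-∋ 1F a b (backward e refl)       = swap (via-leaf₃ refl refl)
  upward-∋ 2F a b (backward e refl)       = swap (via-leaf₃ refl refl)

  hub-∋ : ∀ i b → HasEdge (star (hub , b)) ∞ (pt i b)
  hub-∋ 0F b = via-leaf₁ refl refl
  hub-∋ 1F b = via-leaf₂ refl refl
  hub-∋ 2F b = via-leaf₃ refl refl

  decode-∋ : ∀ x y → x ≢ y → HasEdge (star (decode x y)) x y
  decode-∋ ∞        ∞        x≢y = ⊥-elim (x≢y refl)
  decode-∋ ∞        (pt j b) _   = hub-∋ j b
  decode-∋ (pt i a) ∞        _   = swap (hub-∋ i a)
  decode-∋ (pt i a) (pt j b) x≢y with step i j
  ... | stay = sameLevel-∋ i a b (offset a b) (x≢y ∘ cong (pt i))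
  ... | up   = upward-∋ i a b (offset a b)
  ... | down = swap (upward-∋ j b a (offset b a))

  decode-stay : ∀ i a b → decode (pt i a) (pt i b) ≡ sameLevel i a b (offset a b)
  decode-stay 0F a b = refl
  decode-stay 1F a b = refl
  decode-stay 2F a b = refl

  decode-up : ∀ i a b → decode (pt i a) (pt (next i) b) ≡ upward i a b (offset a b)
  decode-up 0F a b = refl
  decode-up 1F a b = refl
  decode-up 2F a b = refl

  decode-down : ∀ i a b → decode (pt (next i) b) (pt i a) ≡ upward i a b (offset a b)
  decode-down 0F a b = refl
  decode-down 1F a b = refl
  decode-down 2F a b = refl

  armLeaf₃-decode : ∀ i e z → decode (pt i z) (armLeaf₃ i e z) ≡ (arm i e , z)
                            × decode (armLeaf₃ i e z) (pt i z) ≡ (arm i e , z)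
  armLeaf₃-decode 0F e z = both-orders (offset-elim-backward refl (offset (z ⊕ δ e) z))
  armLeaf₃-decode 1F 0F z = both-orders (offset-elim-same (offset z z))
  armLeaf₃-decode 1F (suc e) z = both-orders (offset-elim-backward refl (offset (z ⊕ δ (suc e)) z))
  armLeaf₃-decode 2F e z = both-orders (offset-elim-backward refl (offset (z ⊕ δ e) z))

  decode-leaf : ∀ k z l → IsLeaf (star (k , z)) l →
    decode (centre (star (k , z))) l ≡ (k , z) × decode l (centre (star (k , z))) ≡ (k , z)
  decode-leaf hub z _ (inj₁ (inj₁ refl)) = refl , refl
  decode-leaf hub z _ (inj₁ (inj₂ refl)) = refl , refl
  decode-leaf hub z _ (inj₂ refl)        = refl , refl
  decode-leaf base z _ (inj₁ (inj₁ refl)) = both-orders (offset-elim-same (offset z z))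
  decode-leaf base z _ (inj₁ (inj₂ refl)) = both-orders (offset-elim-backward (sym (suc-pred z)) (offset z (pred z)))
  decode-leaf base z _ (inj₂ refl)        = both-orders (offset-elim-same (offset z z))
  decode-leaf (arm i e) z _ (inj₁ (inj₁ refl)) =
      trans (decode-stay i z (z ⊕ δ e)) (offset-elim-forward refl (offset z (z ⊕ δ e)))
    , trans (decode-stay i (z ⊕ δ e) z) (offset-elim-backward refl (offset (z ⊕ δ e) z))
  decode-leaf (arm i e) z _ (inj₁ (inj₂ refl)) =
      trans (decode-up i z (z ⊕ δ e)) (offset-elim-forward refl (offset z (z ⊕ δ e)))
    , trans (decode-down i z (z ⊕ δ e)) (offset-elim-forward refl (offset z (z ⊕ δ e)))
  decode-leaf (arm i e) z _ (inj₂ refl) = armLeaf₃-decode i e z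

  decode-∈ : ∀ j x y → HasEdge (star j) x y → decode x y ≡ j
  decode-∈ (k , z) _ y (inj₁ (refl , y-leaf)) = proj₁ (decode-leaf k z y y-leaf)
  decode-∈ (k , z) x _ (inj₂ (refl , x-leaf)) = proj₂ (decode-leaf k z x x-leaf)

  decomposition : IsDecomposition star
  decomposition x y x≢y = decode x y , decode-∋ x y x≢y , λ j j∋xy → sym (decode-∈ j x y j∋xy)

  colour : Block → Vertex
  colour (hub , 0F)      = ∞
  colour (hub , suc c)   = pt 0F (suc c)
  colour (base , z)      = pt 2F z
  colour (arm i e , z)   = pt i (mid z (δ e))

  colour-onto : StrictlySurjective _≡_ colour
  colour-onto ∞        = (hub , 0F) , refl
  colour-onto (pt i c) = (arm i 0F , c ⊕ D) , cong (pt i) (mid-onto c)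

  armLeaf₃-vertex : ∀ i e z → Σ (Fin 3) λ l → Σ Pos λ w → armLeaf₃ i e z ≡ pt l w × Ends z (δ e) w
  armLeaf₃-vertex 0F e z       = _ , _ , refl , inj₂ refl
  armLeaf₃-vertex 1F 0F z      = _ , _ , refl , inj₁ refl
  armLeaf₃-vertex 1F (suc e) z = _ , _ , refl , inj₂ refl
  armLeaf₃-vertex 2F e z       = _ , _ , refl , inj₂ refl

  arm-vertex : ∀ {i e z v} → InStar v (star (arm i e , z)) →
    Σ (Fin 3) λ l → Σ Pos λ w → v ≡ pt l w × Ends z (δ e) w
  arm-vertex (inj₁ refl)               = _ , _ , refl , inj₁ refl
  arm-vertex (inj₂ (inj₁ (inj₁ refl))) = _ , _ , refl , inj₂ refl
  arm-vertex (inj₂ (inj₁ (inj₂ refl))) = _ , _ , refl , inj₂ refl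
  arm-vertex {i} {e} {z} (inj₂ (inj₂ refl)) = armLeaf₃-vertex i e z

  hub-vertex : ∀ {c v} → InStar v (star (hub , c)) → v ≡ ∞ ⊎ Σ (Fin 3) λ l → v ≡ pt l c
  hub-vertex (inj₁ refl)               = inj₁ refl
  hub-vertex (inj₂ (inj₁ (inj₁ refl))) = inj₂ (_ , refl)
  hub-vertex (inj₂ (inj₁ (inj₂ refl))) = inj₂ (_ , refl)
  hub-vertex (inj₂ (inj₂ refl))        = inj₂ (_ , refl)

  base-vertex : ∀ {c v} → InStar v (star (base , c)) → (Σ (Fin 3) λ l → v ≡ pt l c) ⊎ v ≡ pt 1F (pred c)
  base-vertex (inj₁ refl)               = inj₁ (_ , refl)
  base-vertex (inj₂ (inj₁ (inj₁ refl))) = inj₁ (_ , refl)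
  base-vertex (inj₂ (inj₁ (inj₂ refl))) = inj₂ refl
  base-vertex (inj₂ (inj₂ refl))        = inj₁ (_ , refl)

  arm₂-level₁ : ∀ {e z w} → InStar (pt 1F w) (star (arm 2F e , z)) → w ≡ z ⊕ δ e
  arm₂-level₁ (inj₁ ())
  arm₂-level₁ (inj₂ (inj₁ (inj₁ ())))
  arm₂-level₁ (inj₂ (inj₁ (inj₂ ())))
  arm₂-level₁ (inj₂ (inj₂ refl)) = refl

  arm-∌-∞ : ∀ {i e z} → ¬ InStar ∞ (star (arm i e , z))
  arm-∌-∞ ∞∈ with arm-vertex ∞∈
  ... | _ , _ , () , _

  arm-∌-mid : ∀ {i e z l} → ¬ InStar (pt l (mid z (δ e))) (star (arm i e , z))
  arm-∌-mid {e = e} {z} c∈ with arm-vertex c∈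
  ... | _ , _ , eq , w∈ = mid-∉-ends z e (subst (Ends z (δ e)) (sym (pt-injectiveʳ eq)) w∈)

  arm-arm-disjoint : ∀ {i i' e e' z z'} → mid z (δ e) ≡ mid z' (δ e') → e ≢ e' →
    VertexDisjoint (star (arm i e , z)) (star (arm i' e' , z'))
  arm-arm-disjoint {e' = e'} {z' = z'} c≡c' e≢e' v (v∈ , v∈') with arm-vertex v∈ | arm-vertex v∈'
  ... | _ , _ , refl , w∈ | _ , _ , eq , w∈' =
    ends-disjoint c≡c' e≢e' w∈ (subst (Ends z' (δ e')) (sym (pt-injectiveʳ eq)) w∈')

  arm-hub-disjoint : ∀ {i e z c} → mid z (δ e) ≡ c → VertexDisjoint (star (arm i e , z)) (star (hub , c))
  arm-hub-disjoint refl v (v∈arm , v∈hub) with hub-vertex v∈hub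
  ... | inj₁ refl       = arm-∌-∞ v∈arm
  ... | inj₂ (_ , refl) = arm-∌-mid v∈arm

  arm-base-disjoint : ∀ {e z c} → mid z (δ e) ≡ c → VertexDisjoint (star (arm 2F e , z)) (star (base , c))
  arm-base-disjoint {e} {z} refl v (v∈arm , v∈base) with base-vertex v∈base
  ... | inj₁ (_ , refl) = arm-∌-mid v∈arm
  ... | inj₂ refl       = pred-mid-≢-far-end (ℕ.s≤s (ℕ.s≤s ℕ.z≤n)) z e (arm₂-level₁ v∈arm)

  colour-disjoint : ∀ j j' → j ≢ j' → colour j ≡ colour j' → VertexDisjoint (star j) (star j')
  colour-disjoint (arm i e , z) (arm _ e' , z') j≢j' same-colour with pt-injectiveˡ same-colour | e Fin.≟ e'
  ... | refl | yes refl = ⊥-elim (j≢j' (cong (arm i e ,_) (mid-cancelʳ (δ e) (pt-injectiveʳ same-colour))))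
  ... | refl | no e≢e'  = arm-arm-disjoint (pt-injectiveʳ same-colour) e≢e'
  colour-disjoint (arm i e , z) (hub , suc c) _ same-colour with pt-injectiveˡ same-colour
  ... | refl = arm-hub-disjoint (pt-injectiveʳ same-colour)
  colour-disjoint (arm i e , z) (base , c) _ same-colour with pt-injectiveˡ same-colour
  ... | refl = arm-base-disjoint (pt-injectiveʳ same-colour)
  colour-disjoint (hub , suc c) (arm i e , z) _ same-colour with pt-injectiveˡ same-colour
  ... | refl = VertexDisjoint-sym {s = star (arm i e , z)} {star (hub , suc c)} (arm-hub-disjoint (sym (pt-injectiveʳ same-colour)))
  colour-disjoint (base , c) (arm i e , z) _ same-colour with pt-injectiveˡ same-colour
  ... | refl = VertexDisjoint-sym {s = star (arm 2F e , z)} {star (base , c)} (arm-base-disjoint (sym (pt-injectiveʳ same-colour)))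
  colour-disjoint (hub , 0F) (hub , 0F) j≢j' _ = ⊥-elim (j≢j' refl)
  colour-disjoint (hub , suc c) (hub , suc c') j≢j' same-colour = ⊥-elim (j≢j' (cong (hub ,_) (pt-injectiveʳ same-colour)))
  colour-disjoint (base , c) (base , c') j≢j' same-colour = ⊥-elim (j≢j' (cong (base ,_) (pt-injectiveʳ same-colour)))
  colour-disjoint (arm _ _ , _) (hub , 0F) _ ()
  colour-disjoint (hub , 0F) (arm _ _ , _) _ ()
  colour-disjoint (hub , 0F) (hub , suc _) _ ()
  colour-disjoint (hub , suc _) (hub , 0F) _ ()
  colour-disjoint (hub , 0F) (base , _) _ ()
  colour-disjoint (base , _) (hub , 0F) _ ()
  colour-disjoint (hub , suc _) (base , _) _ ()
  colour-disjoint (base , _) (hub , suc _) _ ()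

  colouring : IsColouring star colour
  colouring = colour-onto , colour-disjoint

  order : ℕ
  order = suc (3 ℕ.* s)

  vertices : Vertex ↔ Fin order
  vertices = mk↔ₛ′ to from to∘from from∘to
    where
    to : Vertex → Fin order
    to ∞        = 0F
    to (pt i a) = suc (Fin.combine i a)

    from : Fin order → Vertex
    from 0F      = ∞
    from (suc k) = uncurry pt (Fin.remQuot s k)

    to∘from : ∀ k → to (from k) ≡ k
    to∘from 0F      = refl
    to∘from (suc k) = cong suc (Fin.combine-remQuot {3} s k)

    from∘to : ∀ v → from (to v) ≡ v
    from∘to ∞        = refl
    from∘to (pt i a) = cong (uncurry pt) (Fin.remQuot-combine i a)

  kinds : Kind ↔ Fin (2 ℕ.+ 3 ℕ.* D)
  kinds = mk↔ₛ′ to from to∘from from∘to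
    where
    to : Kind → Fin (2 ℕ.+ 3 ℕ.* D)
    to hub       = 0F
    to base      = 1F
    to (arm i e) = suc (suc (Fin.combine i e))

    from : Fin (2 ℕ.+ 3 ℕ.* D) → Kind
    from 0F            = hub
    from 1F            = base
    from (suc (suc k)) = uncurry arm (Fin.remQuot D k)

    to∘from : ∀ k → to (from k) ≡ k
    to∘from 0F            = refl
    to∘from 1F            = refl
    to∘from (suc (suc k)) = cong (λ k → suc (suc k)) (Fin.combine-remQuot {3} D k)

    from∘to : ∀ k → from (to k) ≡ k
    from∘to hub       = refl
    from∘to base      = refl
    from∘to (arm i e) = cong (uncurry arm) (Fin.remQuot-combine i e)

  blocks : Block ↔ Fin ((2 ℕ.+ 3 ℕ.* D) ℕ.* s)
  blocks = ↔-trans (kinds ×-↔ ↔-refl) (↔-sym Fin.*↔×)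

  colourableStarSystem : Σ (List (Star (Fin order))) λ B → IsStarSystem order B × BlockColourable B order
  colourableStarSystem = toStarSystem vertices blocks {f = star} decomposition colouring

private
  order-of-quotient : ∀ {n} q → n ≥ 16 → n ≡ 4 ℕ.+ q ℕ.* 6 → Σ ℕ λ D′ → n ≡ Construction.order D′
  order-of-quotient 0 n≥16 refl = ⊥-elim (ℕ.<⇒≱ (ℕ.m≤m+n 5 11) n≥16)
  order-of-quotient 1 n≥16 refl = ⊥-elim (ℕ.<⇒≱ (ℕ.m≤m+n 11 5) n≥16)
  order-of-quotient (suc (suc D′)) _ refl = D′ , regroup D′
    where
    regroup : ∀ k → 4 ℕ.+ (2 ℕ.+ k) ℕ.* 6 ≡ suc (3 ℕ.* suc ((2 ℕ.+ k) ℕ.+ (2 ℕ.+ k)))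
    regroup = ℕSolver.solve-∀

≡4-mod-6⇒order : ∀ n → n ≥ 16 → n % 6 ≡ 4 → Σ ℕ λ D′ → n ≡ Construction.order D′
≡4-mod-6⇒order n n≥16 n%6≡4 =
  order-of-quotient (n / 6) n≥16 (trans (m≡m%n+[m/n]*n n 6) (cong (ℕ._+ n / 6 ℕ.* 6) n%6≡4))

colourableStarSystem-≡4-mod-6 : ∀ n → n ≥ 16 → n % 6 ≡ 4 →
  Σ (List (Star (Fin n))) λ B → IsStarSystem n B × BlockColourable B n
colourableStarSystem-≡4-mod-6 n n≥16 n%6≡4 with ≡4-mod-6⇒order n n≥16 n%6≡4
... | D′ , refl = Construction.colourableStarSystem D′

theorem4p2 : (n : ℕ) → n ≥ 16 → n % 12 ≡ 4 →
    Σ (List (Star (Fin n))) λ B → IsStarSystem n B × BlockColourable B n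
theorem4p2 n n≥16 n%12≡4 = colourableStarSystem-≡4-mod-6 n n≥16 n%6≡4
  where
  n%6≡4 : n % 6 ≡ 4
  n%6≡4 = trans (sym (m∣n⇒o%n%m≡o%m 6 12 n (divides 2 refl))) (cong (_% 6) n%12≡4)
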